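{- Let $v$ be a positive integer and $K$ a set of positive integers. If there exists a $(v,K,1)$ pairwise balanced design and there exists a Fano Kaleidoscope FK$(k)$ for every $k\in K$, then there exists a Fano Kaleidoscope FK$(v)$.
   Context: A $(v,K,1)$ pairwise balanced design is a pair $(\mathcal V,\mathcal B)$ with $|\mathcal V|=v$ and $\mathcal B$ a set of subsets (blocks) of $\mathcal V$ with $|B|\in K$ for all $B\in\mathcal B$, such that each pair of distinct points lies in exactly one block. A Fano Kaleidoscope FK$(v)$ is a set $\mathcal F$ of Fano planes (2-$(7,3,1)$ designs) whose points lie in a $v$-set $\mathcal V$, the seven lines of each plane colored with seven distinct colors $c_0,\dots,c_6$, such that for any two distinct points $x,y\in\mathcal V$ and any color $c_i$ there is exactly one plane of $\mathcal F$ whose $c_i$-colored line contains $x$ and $y$. -}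

module Defs where

open import Data.Nat using (ℕ; _<_; _≥_)
open import Data.Fin using (Fin)
open import Data.Fin.Subset using (Subset; _∈_; ∣_∣; ⋃)
open import Data.List using (tabulate)
open import Data.Product using (Σ; _×_)
open import Relation.Binary.PropositionalEquality using (_≡_; _≢_)
open import Function.Definitions using (Injective)

ExactlyOne : ∀ {A : Set} → (A → Set) → Set
ExactlyOne {A} P = Σ A (λ i → P i × (∀ j → P j → j ≡ i))

-- A (v,K,1) pairwise balanced design on the point set Fin v.
-- Blocks are indexed by Fin b; injectivity makes the blocks a *set* of subsets.
record PBD (v : ℕ) (K : ℕ → Set) : Set where
  field
    b           : ℕ
    block       : Fin b → Subset v
    blocksDistinct : Injective _≡_ _≡_ block
    blockSizes  : ∀ i → K ∣ block i ∣
    pairCovered : ∀ (x y : Fin v) → x ≢ y →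
                  ExactlyOne (λ i → x ∈ block i × y ∈ block i)

-- A Fano plane (2-(7,3,1) design) whose points lie in Fin v, with its seven lines
-- coloured by the seven colours c₀,…,c₆ = Fin 7 (line c is the c-coloured line;
-- distinct colours on distinct lines follows from the design axiom).
record ColouredFanoPlane (v : ℕ) : Set where
  field
    line       : Fin 7 → Subset v
    lineSize   : ∀ c → ∣ line c ∣ ≡ 3
  points : Subset v
  points = ⋃ (tabulate line)
  field
    pointCount : ∣ points ∣ ≡ 7
    pairLine   : ∀ (x y : Fin v) → x ∈ points → y ∈ points → x ≢ y →
                 ExactlyOne (λ c → x ∈ line c × y ∈ line c)

-- A Fano Kaleidoscope FK(v) on the point set Fin v.  (Planes are indexed by Fin n;
-- repeated planes are automatically excluded by colourPair, since every plane
-- has a pair of points on each coloured line.)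
record FanoKaleidoscope (v : ℕ) : Set where
  field
    n      : ℕ
    plane  : Fin n → ColouredFanoPlane v
    colourPair : ∀ (x y : Fin v) → x ≢ y → ∀ (c : Fin 7) →
                 ExactlyOne (λ i → x ∈ ColouredFanoPlane.line (plane i) c
                                 × y ∈ ColouredFanoPlane.line (plane i) c)

module Submission where

-- Given a (v,K,1) design with blocks B₁,…,B_b and, for every block, a
-- Fano Kaleidoscope FK(∣Bᵢ∣), transport every coloured Fano plane of the
-- kaleidoscope on Bᵢ into the point set Fin v along the order-preserving
-- embedding Fin ∣Bᵢ∣ → Bᵢ.  The union of all transported planes is an FK(v):
-- two distinct points x, y lie in exactly one block Bᵢ, and any plane that
-- places x and y on its c-coloured line comes from the kaleidoscope on that
-- very block, where the plane is unique.

open import Defs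
open import Data.Nat using (ℕ; _<_; _≥_; zero; suc; _+_)
open import Data.Fin using (Fin; zero; suc)
open import Data.Fin.Properties using (+↔⊎; suc-injective)
open import Data.Fin.Subset using (Subset; _∈_; _⊆_; ∣_∣; ⋃; _∪_; ⊥)
open import Data.Vec using (_∷_; [])
open import Data.Vec.Base using (here; there)
open import Data.List using (List; tabulate; map) renaming ([] to []ₗ; _∷_ to _∷ₗ_)
open import Data.List.Properties using (map-tabulate)
open import Data.Product using (Σ; _×_; _,_)
open import Data.Sum using (_⊎_; inj₁; inj₂)
open import Data.Sum.Function.Propositional using (_⊎-↔_)
open import Data.Bool using (true; false; _∨_)
open import Function using (_∘_; _↔_; mk↔ₛ′; Inverse)
open import Function.Properties.Inverse using (↔-trans; ↔-refl)
open import Relation.Binary.PropositionalEquality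
  using (_≡_; _≢_; refl; sym; trans; cong; subst; module ≡-Reasoning)

-- `embed B S` is the image of S ⊆ Fin ∣B∣ under the order-preserving
-- bijection Fin ∣B∣ → B, viewed as a subset of the ambient Fin v.
embed : ∀ {v} (B : Subset v) → Subset ∣ B ∣ → Subset v
embed []          S       = []
embed (true  ∷ B) (s ∷ S) = s ∷ embed B S
embed (false ∷ B) S       = false ∷ embed B S

rank : ∀ {v} (B : Subset v) {x : Fin v} → x ∈ B → Fin ∣ B ∣
rank (true  ∷ B) here      = zero
rank (true  ∷ B) (there h) = suc (rank B h)
rank (false ∷ B) (there h) = rank B h

-- The embedding is injective, so it preserves sizes.
∣embed∣ : ∀ {v} (B : Subset v) (S : Subset ∣ B ∣) → ∣ embed B S ∣ ≡ ∣ S ∣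
∣embed∣ []          []          = refl
∣embed∣ (true  ∷ B) (true  ∷ S) = cong suc (∣embed∣ B S)
∣embed∣ (true  ∷ B) (false ∷ S) = ∣embed∣ B S
∣embed∣ (false ∷ B) S           = ∣embed∣ B S

embed⊆ : ∀ {v} (B : Subset v) (S : Subset ∣ B ∣) → embed B S ⊆ B
embed⊆ (true  ∷ B) (s ∷ S) here      = here
embed⊆ (true  ∷ B) (s ∷ S) (there h) = there (embed⊆ B S h)
embed⊆ (false ∷ B) S       (there h) = there (embed⊆ B S h)

∈-embed⁻ : ∀ {v} (B : Subset v) (S : Subset ∣ B ∣) {x} (x∈B : x ∈ B) →
           x ∈ embed B S → rank B x∈B ∈ S
∈-embed⁻ (true  ∷ B) (s ∷ S) here      here      = here
∈-embed⁻ (true  ∷ B) (s ∷ S) (there h) (there e) = there (∈-embed⁻ B S h e)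
∈-embed⁻ (false ∷ B) S       (there h) (there e) = ∈-embed⁻ B S h e

∈-embed⁺ : ∀ {v} (B : Subset v) (S : Subset ∣ B ∣) {x} (x∈B : x ∈ B) →
           rank B x∈B ∈ S → x ∈ embed B S
∈-embed⁺ (true  ∷ B) (s ∷ S) here      here      = here
∈-embed⁺ (true  ∷ B) (s ∷ S) (there h) (there e) = there (∈-embed⁺ B S h e)
∈-embed⁺ (false ∷ B) S       (there h) e         = there (∈-embed⁺ B S h e)

rank-injective : ∀ {v} (B : Subset v) {x y} (x∈B : x ∈ B) (y∈B : y ∈ B) →
                 rank B x∈B ≡ rank B y∈B → x ≡ y
rank-injective (true  ∷ B) here       here       _  = refl
rank-injective (true  ∷ B) here       (there _)  ()
rank-injective (true  ∷ B) (there _)  here       ()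
rank-injective (true  ∷ B) (there hx) (there hy) eq =
  cong suc (rank-injective B hx hy (suc-injective eq))
rank-injective (false ∷ B) (there hx) (there hy) eq =
  cong suc (rank-injective B hx hy eq)

embed-∪ : ∀ {v} (B : Subset v) (S T : Subset ∣ B ∣) →
          embed B (S ∪ T) ≡ embed B S ∪ embed B T
embed-∪ []          []      []      = refl
embed-∪ (true  ∷ B) (s ∷ S) (t ∷ T) = cong ((s ∨ t) ∷_) (embed-∪ B S T)
embed-∪ (false ∷ B) S       T       = cong (false ∷_) (embed-∪ B S T)

embed-⊥ : ∀ {v} (B : Subset v) → embed B ⊥ ≡ ⊥
embed-⊥ []          = refl
embed-⊥ (true  ∷ B) = cong (false ∷_) (embed-⊥ B)
embed-⊥ (false ∷ B) = cong (false ∷_) (embed-⊥ B)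

embed-⋃ : ∀ {v} (B : Subset v) (Ss : List (Subset ∣ B ∣)) →
          embed B (⋃ Ss) ≡ ⋃ (map (embed B) Ss)
embed-⋃ B []ₗ       = embed-⊥ B
embed-⋃ B (S ∷ₗ Ss) = begin
  embed B (S ∪ ⋃ Ss)              ≡⟨ embed-∪ B S (⋃ Ss) ⟩
  embed B S ∪ embed B (⋃ Ss)      ≡⟨ cong (embed B S ∪_) (embed-⋃ B Ss) ⟩
  embed B S ∪ ⋃ (map (embed B) Ss) ∎
  where open ≡-Reasoning

embedPlane : ∀ {v} (B : Subset v) → ColouredFanoPlane ∣ B ∣ → ColouredFanoPlane v
embedPlane {v} B P = record
  { line       = embed B ∘ line
  ; lineSize   = λ c → trans (∣embed∣ B (line c)) (lineSize c)
  ; pointCount = trans (cong ∣_∣ (sym points-embed)) (trans (∣embed∣ B points) pointCount)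
  ; pairLine   = pairLine′
  }
  where
  open ColouredFanoPlane P

  points-embed : embed B points ≡ ⋃ (tabulate (embed B ∘ line))
  points-embed = trans (embed-⋃ B (tabulate line)) (cong ⋃ (map-tabulate line (embed B)))

  -- Two points of the transported plane have distinct ranks, so their common
  -- line is the transport of the unique common line of the ranks in P.
  pairLine′ : ∀ (x y : Fin v) → x ∈ ⋃ (tabulate (embed B ∘ line)) →
              y ∈ ⋃ (tabulate (embed B ∘ line)) → x ≢ y →
              ExactlyOne (λ c → x ∈ embed B (line c) × y ∈ embed B (line c))
  pairLine′ x y x∈ y∈ x≢y
    with x∈P ← subst (x ∈_) (sym points-embed) x∈
       | y∈P ← subst (y ∈_) (sym points-embed) y∈
    with x∈B ← embed⊆ B points x∈P
       | y∈B ← embed⊆ B points y∈P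
    with (c , (x∈c , y∈c) , unique) ←
           pairLine (rank B x∈B) (rank B y∈B)
                    (∈-embed⁻ B points x∈B x∈P) (∈-embed⁻ B points y∈B y∈P)
                    (x≢y ∘ rank-injective B x∈B y∈B)
    = c , (∈-embed⁺ B (line c) x∈B x∈c , ∈-embed⁺ B (line c) y∈B y∈c)
    , λ c′ (x∈c′ , y∈c′) →
        unique c′ (∈-embed⁻ B (line c′) x∈B x∈c′ , ∈-embed⁻ B (line c′) y∈B y∈c′)

OnLine : ∀ {v} → ColouredFanoPlane v → Fin 7 → Fin v → Fin v → Set
OnLine P c x y = x ∈ ColouredFanoPlane.line P c × y ∈ ColouredFanoPlane.line P c

ColourPairProperty : ∀ {v} {I : Set} → (I → ColouredFanoPlane v) → Set
ColourPairProperty {v} plane =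
  ∀ (x y : Fin v) → x ≢ y → ∀ c → ExactlyOne (λ i → OnLine (plane i) c x y)

module _ {v : ℕ} {K : ℕ → Set} (D : PBD v K)
         (F : ∀ i → FanoKaleidoscope ∣ PBD.block D i ∣) where
  open PBD D
  open FanoKaleidoscope using (n; plane; colourPair)

  BlockPlane : Set
  BlockPlane = Σ (Fin b) (λ i → Fin (n (F i)))

  blockPlane : BlockPlane → ColouredFanoPlane v
  blockPlane (i , p) = embedPlane (block i) (plane (F i) p)

  -- Two distinct points lie on the c-line of exactly one block plane: the
  -- block is forced by the PBD, the plane within it by the kaleidoscope F i.
  blockPlane-colourPair : ColourPairProperty blockPlane
  blockPlane-colourPair x y x≢y c
    with (i , (x∈B , y∈B) , block-unique) ← pairCovered x y x≢y
    with (p , (x∈c , y∈c) , plane-unique) ←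
           colourPair (F i) (rank (block i) x∈B) (rank (block i) y∈B)
                      (x≢y ∘ rank-injective (block i) x∈B y∈B) c
    = (i , p)
    , (∈-embed⁺ (block i) _ x∈B x∈c , ∈-embed⁺ (block i) _ y∈B y∈c)
    , unique
    where
    unique : ∀ jq → OnLine (blockPlane jq) c x y → jq ≡ (i , p)
    unique (j , q) (x∈c′ , y∈c′)
      with refl ← block-unique j (embed⊆ (block j) _ x∈c′ , embed⊆ (block j) _ y∈c′)
      = cong (i ,_) (plane-unique q (∈-embed⁻ (block i) _ x∈B x∈c′ ,
                                     ∈-embed⁻ (block i) _ y∈B y∈c′))

ExactlyOne-↔ : ∀ {A B : Set} (e : A ↔ B) {P : B → Set} →
               ExactlyOne P → ExactlyOne (P ∘ Inverse.to e)
ExactlyOne-↔ e {P} (b , Pb , unique) =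
  from b , subst P (sym (strictlyInverseˡ b)) Pb ,
  λ a Pa → trans (sym (strictlyInverseʳ a)) (cong from (unique (to a) Pa))
  where open Inverse e

∑ : (m : ℕ) → (Fin m → ℕ) → ℕ
∑ zero    n = 0
∑ (suc m) n = n zero + ∑ m (n ∘ suc)

Σ-Fin-suc↔ : ∀ {m : ℕ} (n : Fin (suc m) → ℕ) →
             (Fin (n zero) ⊎ Σ (Fin m) (Fin ∘ n ∘ suc)) ↔ Σ (Fin (suc m)) (Fin ∘ n)
Σ-Fin-suc↔ {m} n = mk↔ₛ′ to from to∘from from∘to
  where
  to : Fin (n zero) ⊎ Σ (Fin m) (Fin ∘ n ∘ suc) → Σ (Fin (suc m)) (Fin ∘ n)
  to (inj₁ p)       = zero , p
  to (inj₂ (i , p)) = suc i , p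
  from : Σ (Fin (suc m)) (Fin ∘ n) → Fin (n zero) ⊎ Σ (Fin m) (Fin ∘ n ∘ suc)
  from (zero  , p) = inj₁ p
  from (suc i , p) = inj₂ (i , p)
  to∘from : ∀ ip → to (from ip) ≡ ip
  to∘from (zero  , p) = refl
  to∘from (suc i , p) = refl
  from∘to : ∀ s → from (to s) ≡ s
  from∘to (inj₁ p) = refl
  from∘to (inj₂ _) = refl

Σ-Fin↔ : ∀ m (n : Fin m → ℕ) → Fin (∑ m n) ↔ Σ (Fin m) (Fin ∘ n)
Σ-Fin↔ zero    n = mk↔ₛ′ (λ ()) (λ ()) (λ ()) (λ ())
Σ-Fin↔ (suc m) n =
  ↔-trans +↔⊎ (↔-trans (↔-refl ⊎-↔ Σ-Fin↔ m (n ∘ suc)) (Σ-Fin-suc↔ n))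

proposition10 : (v : ℕ) → v ≥ 1 → (K : ℕ → Set) → (∀ k → K k → 0 < k) →
    PBD v K → (∀ k → K k → FanoKaleidoscope k) → FanoKaleidoscope v
proposition10 v _ K _ D fk = record
  { n          = ∑ b planeCount
  ; plane      = blockPlane D F ∘ Inverse.to enumeration
  ; colourPair = λ x y x≢y c →
      ExactlyOne-↔ enumeration (blockPlane-colourPair D F x y x≢y c)
  }
  where
  open PBD D
  F : ∀ i → FanoKaleidoscope ∣ block i ∣
  F i = fk ∣ block i ∣ (blockSizes i)
  planeCount : Fin b → ℕ
  planeCount i = FanoKaleidoscope.n (F i)
  enumeration : Fin (∑ b planeCount) ↔ BlockPlane D F
  enumeration = Σ-Fin↔ b planeCount
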